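{- Let $\Sigma$ be an alphabet of size $\sigma \ge 2$ and $T$ a string of length $n$ over $\Sigma$. For any $1 \le i \le j < n$, \[ |\mathsf{MUS}(T[i..j+1]) \bigtriangleup \mathsf{MUS}(T[i..j])| \le 4 \quad\text{and}\quad -1 \le |\mathsf{MUS}(T[i..j+1])| - |\mathsf{MUS}(T[i..j])| \le 2 . \] Furthermore, these bounds are tight for any $\sigma, i, j$ with $\sigma \ge 3$, $1 \le i \le j < n$ and $j-i+1 \ge 5$: for such parameters each of the three bounds (the value $4$, the value $2$, and the value $-1$) is attained by some string $T$ over an alphabet of size $\sigma$.
   Context: For a string $W$, $W[k]$ is its $k$-th character and $W[a..b]$ is the substring from position $a$ to position $b$ (the empty string $\varepsilon$ if $a > b$). For strings $w, W$, $\#\mathit{occ}_W(w)$ is the number of positions at which $w$ occurs in $W$, with the convention $\#\mathit{occ}_W(\varepsilon) = |W|+1$. A substring $w$ of $W$ is unique in $W$ if $\#\mathit{occ}_W(w)=1$ and repeating in $W$ if $\#\mathit{occ}_W(w)\ge 2$. For $1 \le i \le j \le n$, $\mathsf{MUS}(T[i..j])$ is the set of intervals $[s,t]$ with $i \le s \le t \le j$ (positions refer to $T$) such that $T[s..t]$ is unique in $T[i..j]$ and both $T[s+1..t]$ and $T[s..t-1]$ are repeating in $T[i..j]$ (these are the minimal unique substrings of the window $T[i..j]$). $\bigtriangleup$ denotes symmetric difference. -}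

module Defs where

open import Data.Nat using (ℕ; zero; suc; _+_; _∸_; _≤_; _<_; _≤?_; _<?_)
open import Data.Nat.Properties using (_≟_)
open import Data.Fin using (Fin; toℕ; fromℕ<)
import Data.Fin.Properties as FinP
open import Data.Vec using (Vec; lookup)
open import Data.Maybe using (Maybe; just; nothing)
import Data.Maybe.Properties as MaybeP
open import Data.List using (List; length; filter; upTo; cartesianProduct)
open import Data.Product using (_×_; _,_; proj₁; proj₂)
open import Data.Sum using (_⊎_)
open import Relation.Nullary using (¬_; Dec; yes; no)
open import Relation.Nullary.Decidable using (_×-dec_; _⊎-dec_; ¬?)
open import Relation.Binary.PropositionalEquality using (_≡_)

-- Strings of length n over the alphabet Fin σ (an alphabet of size σ).
-- Character at 1-based position k of T (nothing if k is out of range 1..n).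
at : ∀ {σ n} → Vec (Fin σ) n → ℕ → Maybe (Fin σ)
at T zero = nothing
at {n = n} T (suc k) with k <? n
... | yes k<n = just (lookup T (fromℕ< k<n))
... | no _ = nothing

OccAt : ∀ {σ n} → Vec (Fin σ) n → (i j a L p : ℕ) → Set
OccAt T i j a L p =
  (i ≤ p) × ((p + L ≤ suc j) × (∀ (k : Fin L) → at T (p + toℕ k) ≡ at T (a + toℕ k)))

occAt? : ∀ {σ n} (T : Vec (Fin σ) n) (i j a L p : ℕ) → Dec (OccAt T i j a L p)
occAt? T i j a L p =
  (i ≤? p) ×-dec ((p + L ≤? suc j) ×-dec
    FinP.all? (λ k → MaybeP.≡-dec FinP._≟_ (at T (p + toℕ k)) (at T (a + toℕ k))))

-- #occ_{T[i..j]}(T[a..a+L-1]): number of positions of the window at which the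
-- substring occurs.  (Candidate positions p range over 0..j+1; for the empty
-- string (L = 0) this gives |W|+1 = j-i+2 when 1 ≤ i ≤ j, as in the convention.)
occ : ∀ {σ n} → Vec (Fin σ) n → (i j a L : ℕ) → ℕ
occ T i j a L = length (filter (occAt? T i j a L) (upTo (suc (suc j))))

IsMUS : ∀ {σ n} → Vec (Fin σ) n → (i j : ℕ) → ℕ × ℕ → Set
IsMUS T i j (s , t) =
  (i ≤ s) × ((s ≤ t) × ((t ≤ j) ×
  ((occ T i j s (suc t ∸ s) ≡ 1) ×
  ((2 ≤ occ T i j (suc s) (t ∸ s)) ×
   (2 ≤ occ T i j s (t ∸ s))))))

isMUS? : ∀ {σ n} (T : Vec (Fin σ) n) (i j : ℕ) (x : ℕ × ℕ) → Dec (IsMUS T i j x)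
isMUS? T i j (s , t) =
  (i ≤? s) ×-dec ((s ≤? t) ×-dec ((t ≤? j) ×-dec
  ((occ T i j s (suc t ∸ s) ≟ 1) ×-dec
  ((2 ≤? occ T i j (suc s) (t ∸ s)) ×-dec
   (2 ≤? occ T i j s (t ∸ s))))))

-- All candidate intervals [s,t] with 0 ≤ s,t ≤ n (each interval listed once).
-- Every element of MUS(T[i..j]) with j ≤ n is among them.
candidates : ℕ → List (ℕ × ℕ)
candidates n = cartesianProduct (upTo (suc n)) (upTo (suc n))

MUS : ∀ {σ n} → Vec (Fin σ) n → (i j : ℕ) → List (ℕ × ℕ)
MUS {n = n} T i j = filter (isMUS? T i j) (candidates n)

#MUS : ∀ {σ n} → Vec (Fin σ) n → (i j : ℕ) → ℕ
#MUS T i j = length (MUS T i j)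

InSymDiff : ∀ {σ n} → Vec (Fin σ) n → (i j i' j' : ℕ) → ℕ × ℕ → Set
InSymDiff T i j i' j' x =
  (IsMUS T i j x × ¬ IsMUS T i' j' x) ⊎ (¬ IsMUS T i j x × IsMUS T i' j' x)

inSymDiff? : ∀ {σ n} (T : Vec (Fin σ) n) (i j i' j' : ℕ) (x : ℕ × ℕ) → Dec (InSymDiff T i j i' j' x)
inSymDiff? T i j i' j' x =
  (isMUS? T i j x ×-dec ¬? (isMUS? T i' j' x)) ⊎-dec (¬? (isMUS? T i j x) ×-dec isMUS? T i' j' x)

#SymDiff : ∀ {σ n} → Vec (Fin σ) n → (i j i' j' : ℕ) → ℕ
#SymDiff {n = n} T i j i' j' = length (filter (inSymDiff? T i j i' j') (candidates n))

-- Extending the window T[i..j] by T[j+1] only creates occurrences that are suffixes of T[i..j+1].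
-- A lost MUS has therefore acquired such a suffix occurrence.  Two strings that are unique in T[i..j]
-- and match suffixes of T[i..j+1] end at the same place (the shorter one reappears inside the window
-- occurrence of the longer one), and an MUS is determined by its end, so at most one MUS is lost.
-- A gained MUS either ends at j+1, which happens at most once, or ends inside T[i..j]; then its tail
-- or its head is unique in T[i..j] but repeats in T[i..j+1], and the same argument allows at most one
-- gain of each of these two kinds.  Such a newly repeating string contains an MUS of T[i..j] which
-- repeats along with it, so gains inside the window force a loss: gained ≤ lost + 2 and lost ≤ 1.
-- For tightness, appending 1 to 0⋯0 1 2 2 (at least two 0s) gains 01, 12, 21 and loses 1, and
-- appending 0 to 0 0 1⋯1 0 (at least two 1s) loses 00 and gains nothing.

module Submission where

open import Defs
open import Data.Nat using (ℕ; zero; suc; _+_; _∸_; _≤_; _<_; z≤n; s≤s; _≤?_; _<?_)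
open import Data.Nat.Properties
open import Data.Nat.Tactic.RingSolver using (solve-∀)
open import Data.Fin using (Fin; toℕ; fromℕ<) renaming (zero to fzero; suc to fsuc)
open import Data.Fin.Properties using (toℕ<n; toℕ-fromℕ<)
open import Data.Vec using (Vec; tabulate)
open import Data.Vec.Properties using (lookup∘tabulate)
open import Data.Maybe using (just)
open import Data.Maybe.Properties using (just-injective)
open import Data.List using (List; []; _∷_; length; filter; upTo)
open import Data.List.Properties using (filter-none)
open import Data.List.Membership.Propositional using (_∈_)
open import Data.List.Membership.Propositional.Properties using (∈-filter⁺; ∈-filter⁻; ∈-upTo⁺; ∈-cartesianProduct⁺)
open import Data.List.Relation.Binary.Sublist.Heterogeneous.Properties using (length-mono-≤)
open import Data.List.Relation.Binary.Sublist.Propositional using (⊆-refl)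
open import Data.List.Relation.Binary.Sublist.Propositional.Properties using (filter⁺)
import Data.List.Relation.Unary.All as All
open import Data.List.Relation.Unary.All using (_∷_)
open import Data.List.Relation.Unary.AllPairs using (_∷_)
open import Data.List.Relation.Unary.Any using (here; there)
import Data.List.Relation.Unary.Unique.Propositional as List
import Data.List.Relation.Unary.Unique.Propositional.Properties as Uniqueₚ
open import Data.Product using (_×_; _,_; proj₁; proj₂; ∃; ∃₂)
open import Data.Sum using (_⊎_; inj₁; inj₂; [_,_]′)
open import Data.Empty using (⊥; ⊥-elim)
open import Function using (_∘_; id; flip)
open import Level using (0ℓ)
open import Relation.Nullary using (¬_; Dec; yes; no; contradiction)
open import Relation.Nullary.Decidable using (_×-dec_; ¬?; map′; True; toWitness)
open import Relation.Unary using (Pred; Decidable; _⊆_)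
open import Relation.Binary using (tri<; tri≈; tri>)
open import Relation.Binary.PropositionalEquality using (_≡_; _≢_; refl; sym; trans; cong; cong₂; subst; subst₂; module ≡-Reasoning)

module _ {A : Set} where

  private variable P Q R : Pred A 0ℓ

  count : Decidable P → List A → ℕ
  count P? xs = length (filter P? xs)

  count-mono : (P? : Decidable P) (Q? : Decidable Q) → P ⊆ Q → ∀ xs → count P? xs ≤ count Q? xs
  count-mono P? Q? P⊆Q xs = length-mono-≤ (filter⁺ P? Q? (λ { refl → P⊆Q }) (⊆-refl {x = xs}))

  count-cong : (P? : Decidable P) (Q? : Decidable Q) → P ⊆ Q → Q ⊆ P → ∀ xs → count P? xs ≡ count Q? xs
  count-cong P? Q? P⊆Q Q⊆P xs = ≤-antisym (count-mono P? Q? P⊆Q xs) (count-mono Q? P? Q⊆P xs)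

  count-split : (P? : Decidable P) (Q? : Decidable Q) → ∀ xs →
                count P? xs ≡ count (λ x → P? x ×-dec Q? x) xs + count (λ x → P? x ×-dec ¬? (Q? x)) xs
  count-split P? Q? [] = refl
  count-split P? Q? (x ∷ xs) with P? x | Q? x
  ... | yes _ | yes _ = cong suc (count-split P? Q? xs)
  ... | yes _ | no _ = trans (cong suc (count-split P? Q? xs)) (sym (+-suc _ _))
  ... | no _ | _ = count-split P? Q? xs

  count-union-≤ : (P? : Decidable P) (Q? : Decidable Q) (R? : Decidable R) →
                  (∀ {x} → P x → Q x ⊎ R x) → ∀ xs → count P? xs ≤ count Q? xs + count R? xs
  count-union-≤ {P = P} {Q} {R} P? Q? R? P⊆Q∪R xs = begin
    count P? xs                                                         ≡⟨ count-split P? Q? xs ⟩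
    count (λ x → P? x ×-dec Q? x) xs + count (λ x → P? x ×-dec ¬? (Q? x)) xs
                                  ≤⟨ +-mono-≤ (count-mono _ Q? proj₂ xs) (count-mono _ R? P∖Q⊆R xs) ⟩
    count Q? xs + count R? xs                                           ∎
    where
      open ≤-Reasoning
      P∖Q⊆R : ∀ {x} → P x × ¬ Q x → R x
      P∖Q⊆R (p , ¬q) = [ flip contradiction ¬q , id ]′ (P⊆Q∪R p)

  count≡0 : (P? : Decidable P) → (∀ {x} → ¬ P x) → ∀ xs → count P? xs ≡ 0
  count≡0 P? ¬P xs = cong length (filter-none P? {xs = xs} (All.tabulate (λ _ → ¬P)))

  ∈⇒1≤count : (P? : Decidable P) → ∀ {x xs} → x ∈ xs → P x → 1 ≤ count P? xs
  ∈⇒1≤count P? {xs = xs} x∈xs px with filter P? xs | ∈-filter⁺ P? x∈xs px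
  ... | _ ∷ _ | _ = s≤s z≤n

  private
    ∈-filter-≡⁻ : (P? : Decidable P) → ∀ {v xs ys} → filter P? xs ≡ ys → v ∈ ys → v ∈ xs × P v
    ∈-filter-≡⁻ P? refl = ∈-filter⁻ P?

  1≤count⇒∈ : (P? : Decidable P) → ∀ xs → 1 ≤ count P? xs → ∃ λ x → x ∈ xs × P x
  1≤count⇒∈ P? xs 1≤n with filter P? xs in eq
  ... | y ∷ _ = y , ∈-filter-≡⁻ P? eq (here refl)

  count≤1 : (P? : Decidable P) → ∀ {xs} → List.Unique xs → (∀ {x y} → P x → P y → x ≡ y) → count P? xs ≤ 1
  count≤1 P? {xs} distinct P-subsingleton with filter P? xs in eq | Uniqueₚ.filter⁺ P? distinct
  ... | [] | _ = z≤n
  ... | _ ∷ [] | _ = s≤s z≤n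
  ... | x ∷ y ∷ _ | (x≢y ∷ _) ∷ _ = ⊥-elim (x≢y (P-subsingleton
        (proj₂ (∈-filter-≡⁻ P? {xs = xs} eq (here refl)))
        (proj₂ (∈-filter-≡⁻ P? {xs = xs} eq (there (here refl))))))

  count≤1⇒≡ : (P? : Decidable P) → ∀ {x y xs} → count P? xs ≤ 1 → x ∈ xs → y ∈ xs → P x → P y → x ≡ y
  count≤1⇒≡ P? {xs = xs} n≤1 x∈xs y∈xs px py
    with filter P? xs | ∈-filter⁺ P? x∈xs px | ∈-filter⁺ P? y∈xs py
  ... | _ ∷ [] | here x≡z | here y≡z = trans x≡z (sym y≡z)
  ... | _ ∷ _ ∷ _ | _ | _ with s≤s () ← n≤1

  distinct⇒2≤count : (P? : Decidable P) → ∀ {x y xs} → x ∈ xs → y ∈ xs → x ≢ y → P x → P y →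
                     2 ≤ count P? xs
  distinct⇒2≤count P? {xs = xs} x∈xs y∈xs x≢y px py with count P? xs ≤? 1
  ... | yes n≤1 = ⊥-elim (x≢y (count≤1⇒≡ P? n≤1 x∈xs y∈xs px py))
  ... | no n≰1 = ≰⇒> n≰1

  2≤count⇒distinct : (P? : Decidable P) → ∀ {xs} → List.Unique xs → 2 ≤ count P? xs →
                     ∃ λ x → ∃ λ y → x ≢ y × (x ∈ xs × P x) × (y ∈ xs × P y)
  2≤count⇒distinct P? {xs} distinct 2≤n with filter P? xs in eq | Uniqueₚ.filter⁺ P? distinct
  ... | _ ∷ [] | _ with s≤s () ← 2≤n
  ... | x ∷ y ∷ _ | (x≢y ∷ _) ∷ _ =
    x , y , x≢y , ∈-filter-≡⁻ P? eq (here refl) , ∈-filter-≡⁻ P? eq (there (here refl))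

module Occurrences {σ n : ℕ} (T : Vec (Fin σ) n) (i : ℕ) where

  private variable J a b L L′ p s s′ l l′ e e′ d : ℕ

  record Match (p a L : ℕ) : Set where
    constructor match
    field agree : ∀ k → k < L → at T (p + k) ≡ at T (a + k)
  open Match public

  record Occurs (J a L p : ℕ) : Set where
    constructor occurs
    field
      left    : i ≤ p
      right   : p + L ≤ suc J
      matches : Match p a L
  open Occurs public

  Repeating : ℕ → ℕ → ℕ → Set
  Repeating J a L = ∃₂ λ p q → p ≢ q × Occurs J a L p × Occurs J a L q

  Unique : ℕ → ℕ → ℕ → Set
  Unique J a L = ∀ {p q} → Occurs J a L p → Occurs J a L q → p ≡ q

  OccAt⇒Occurs : OccAt T i J a L p → Occurs J a L p
  OccAt⇒Occurs {a = a} {p = p} (i≤p , bound , agree) = occurs i≤p bound (match λ k k<L →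
    subst (λ k → at T (p + k) ≡ at T (a + k)) (toℕ-fromℕ< k<L) (agree (fromℕ< k<L)))

  Occurs⇒OccAt : Occurs J a L p → OccAt T i J a L p
  Occurs⇒OccAt (occurs i≤p bound (match agree)) = i≤p , bound , λ k → agree (toℕ k) (toℕ<n k)

  occurs? : ∀ J a L p → Dec (Occurs J a L p)
  occurs? J a L p = map′ OccAt⇒Occurs Occurs⇒OccAt (occAt? T i J a L p)

  Occurs⇒<2+ : Occurs J a L p → p < suc (suc J)
  Occurs⇒<2+ {L = L} {p} o = s≤s (≤-trans (m≤m+n p L) (right o))

  Repeating⇒2≤occ : ∀ {J a L} → Repeating J a L → 2 ≤ occ T i J a L
  Repeating⇒2≤occ {J} {a} {L} (p , q , p≢q , op , oq) = distinct⇒2≤count (occAt? T i J a L)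
    (∈-upTo⁺ (Occurs⇒<2+ op)) (∈-upTo⁺ (Occurs⇒<2+ oq)) p≢q (Occurs⇒OccAt op) (Occurs⇒OccAt oq)

  2≤occ⇒Repeating : ∀ {J a L} → 2 ≤ occ T i J a L → Repeating J a L
  2≤occ⇒Repeating {J} {a} {L} 2≤occ
    with 2≤count⇒distinct (occAt? T i J a L) (Uniqueₚ.upTo⁺ (suc (suc J))) 2≤occ
  ... | p , q , p≢q , (_ , op) , (_ , oq) = p , q , p≢q , OccAt⇒Occurs op , OccAt⇒Occurs oq

  repeating? : ∀ J a L → Dec (Repeating J a L)
  repeating? J a L = map′ 2≤occ⇒Repeating Repeating⇒2≤occ (2 ≤? occ T i J a L)

  Unique⇒occ≡1 : ∀ {J a L} → Unique J a L → Occurs J a L a → occ T i J a L ≡ 1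
  Unique⇒occ≡1 {J} {a} {L} unique oa = ≤-antisym
    (count≤1 (occAt? T i J a L) (Uniqueₚ.upTo⁺ (suc (suc J)))
             λ op oq → unique (OccAt⇒Occurs op) (OccAt⇒Occurs oq))
    (∈⇒1≤count (occAt? T i J a L) (∈-upTo⁺ (Occurs⇒<2+ oa)) (Occurs⇒OccAt oa))

  occ≡1⇒Unique : ∀ {J a L} → occ T i J a L ≡ 1 → Unique J a L
  occ≡1⇒Unique {J} {a} {L} occ≡1 op oq = count≤1⇒≡ (occAt? T i J a L) (≤-reflexive occ≡1)
    (∈-upTo⁺ (Occurs⇒<2+ op)) (∈-upTo⁺ (Occurs⇒<2+ oq)) (Occurs⇒OccAt op) (Occurs⇒OccAt oq)

  Match-refl : Match p p L
  Match-refl = match λ _ _ → refl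

  Match-sym : Match p a L → Match a p L
  Match-sym m = match λ k k<L → sym (agree m k k<L)

  Match-trans : Match p a L → Match a b L → Match p b L
  Match-trans m m′ = match λ k k<L → trans (agree m k k<L) (agree m′ k k<L)

  Match-infix : Match p a L → ∀ d → d + L′ ≤ L → Match (d + p) (d + a) L′
  Match-infix {p} {a} m d d+L′≤L = match λ k k<L′ →
    subst₂-at (swap p d k) (swap a d k) (agree m (d + k) (≤-trans (+-monoʳ-< d k<L′) d+L′≤L))
    where
      swap : ∀ x d k → x + (d + k) ≡ d + x + k
      swap = solve-∀
      subst₂-at : ∀ {x y x′ y′} → x ≡ x′ → y ≡ y′ → at T x ≡ at T y → at T x′ ≡ at T y′
      subst₂-at refl refl eq = eq

  Occurs-self : i ≤ a → a + L ≤ suc J → Occurs J a L a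
  Occurs-self i≤a bound = occurs i≤a bound Match-refl

  Occurs-weaken : Occurs J a L p → Occurs (suc J) a L p
  Occurs-weaken (occurs i≤p bound m) = occurs i≤p (m≤n⇒m≤1+n bound) m

  Occurs-extend : Occurs (suc J) a L p → Occurs J a L p ⊎ p + L ≡ suc (suc J)
  Occurs-extend (occurs i≤p bound m) with m≤n⇒m<n∨m≡n bound
  ... | inj₁ p+L<2+J = inj₁ (occurs i≤p (≤-pred p+L<2+J) m)
  ... | inj₂ p+L≡2+J = inj₂ p+L≡2+J

  Repeating-weaken : Repeating J a L → Repeating (suc J) a L
  Repeating-weaken (p , q , p≢q , op , oq) = p , q , p≢q , Occurs-weaken op , Occurs-weaken oq

  Unique-strengthen : Unique (suc J) a L → Unique J a L
  Unique-strengthen unique op oq = unique (Occurs-weaken op) (Occurs-weaken oq)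

  pinned⇒Unique : (∀ {p} → Occurs J a L p → p ≡ a) → Unique J a L
  pinned⇒Unique pinned op oq = trans (pinned op) (sym (pinned oq))

  Unique⇒¬Repeating : Unique J a L → ¬ Repeating J a L
  Unique⇒¬Repeating unique (p , q , p≢q , op , oq) = p≢q (unique op oq)

  ¬Repeating⇒Unique : ¬ Repeating J a L → Unique J a L
  ¬Repeating⇒Unique ¬rep {p} {q} op oq with p ≟ q
  ... | yes p≡q = p≡q
  ... | no p≢q = ⊥-elim (¬rep (p , q , p≢q , op , oq))

  Repeating-empty : i ≤ J → Repeating J a 0
  Repeating-empty {J} i≤J = i , suc i , <⇒≢ (n<1+n i) ,
    occurs ≤-refl (subst (_≤ suc J) (sym (+-identityʳ i)) (m≤n⇒m≤1+n i≤J)) (match λ _ ()) ,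
    occurs (n≤1+n i) (subst (_≤ suc J) (sym (+-identityʳ (suc i))) (s≤s i≤J)) (match λ _ ())

  Occurs-infix : ∀ {J a L L′ p} → Occurs J a L p → ∀ d → d + L′ ≤ L → Occurs J (d + a) L′ (d + p)
  Occurs-infix {L′ = L′} {p} (occurs i≤p bound m) d d+L′≤L = occurs (≤-trans i≤p (m≤n+m p d))
    (≤-trans (≤-reflexive (swap d p L′)) (≤-trans (+-monoʳ-≤ p d+L′≤L) bound)) (Match-infix m d d+L′≤L)
    where
      swap : ∀ d p L′ → d + p + L′ ≡ p + (d + L′)
      swap = solve-∀

  Repeating-infix : Repeating J a L → ∀ d → d + L′ ≤ L → Repeating J (d + a) L′
  Repeating-infix (p , q , p≢q , op , oq) d d+L′≤L =
    d + p , d + q , (λ eq → p≢q (+-cancelˡ-≡ d p q eq)) ,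
    Occurs-infix op d d+L′≤L , Occurs-infix oq d d+L′≤L

  record MinUnique (J s l : ℕ) : Set where
    constructor minUnique
    field
      left-bound   : i ≤ s
      right-bound  : s + l ≤ J
      unique       : Unique J s (suc l)
      tail-repeats : Repeating J (suc s) l
      init-repeats : Repeating J s l
  open MinUnique public

  MinUnique-occurs : MinUnique J s l → Occurs J s (suc l) s
  MinUnique-occurs {J} {s} {l} mu =
    Occurs-self (left-bound mu) (subst (_≤ suc J) (sym (+-suc s l)) (s≤s (right-bound mu)))

  MinUnique⇒IsMUS : MinUnique J s l → IsMUS T i J (s , s + l)
  MinUnique⇒IsMUS {J} {s} {l} mu@(minUnique i≤s s+l≤J unique tail init) =
    i≤s , m≤m+n s l , s+l≤J ,
    subst (λ L → occ T i J s L ≡ 1) (sym 1+s+l∸s≡1+l) (Unique⇒occ≡1 unique (MinUnique-occurs mu)) ,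
    subst (λ L → 2 ≤ occ T i J (suc s) L) (sym (m+n∸m≡n s l)) (Repeating⇒2≤occ tail) ,
    subst (λ L → 2 ≤ occ T i J s L) (sym (m+n∸m≡n s l)) (Repeating⇒2≤occ init)
    where
      1+s+l∸s≡1+l : suc (s + l) ∸ s ≡ suc l
      1+s+l∸s≡1+l = trans (cong (_∸ s) (sym (+-suc s l))) (m+n∸m≡n s (suc l))

  IsMUS⇒MinUnique : ∀ {J s t} → IsMUS T i J (s , t) → MinUnique J s (t ∸ s)
  IsMUS⇒MinUnique {J} {s} {t} (i≤s , s≤t , t≤J , occ≡1 , tail , init) = minUnique i≤s
    (subst (_≤ J) (sym (m+[n∸m]≡n s≤t)) t≤J)
    (occ≡1⇒Unique (subst (λ L → occ T i J s L ≡ 1) (+-∸-assoc 1 s≤t) occ≡1))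
    (2≤occ⇒Repeating tail) (2≤occ⇒Repeating init)

  IsMUS-+⇒MinUnique : ∀ {J s l} → IsMUS T i J (s , s + l) → MinUnique J s l
  IsMUS-+⇒MinUnique {J} {s} {l} mus = subst (MinUnique J s) (m+n∸m≡n s l) (IsMUS⇒MinUnique mus)

  MinUnique⇒IsMUS′ : ∀ {J s t} → s ≤ t → MinUnique J s (t ∸ s) → IsMUS T i J (s , t)
  MinUnique⇒IsMUS′ {J} {s} s≤t mu = subst (λ t → IsMUS T i J (s , t)) (m+[n∸m]≡n s≤t) (MinUnique⇒IsMUS mu)

  Unique-not-suffix-of-repeating : Unique J s (suc l) → Repeating J (suc s′) l′ → s + l ≡ s′ + l′ → ¬ l < l′
  Unique-not-suffix-of-repeating {J} {s} {l} {s′} {l′} unique tail end≡ l<l′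
    with m≤n⇒∃[o]m+o≡n l<l′
  ... | d , refl = Unique⇒¬Repeating unique (subst (λ x → Repeating J x (suc l)) (sym s≡d+1+s′)
                     (Repeating-infix tail d (≤-reflexive (+-comm d (suc l)))))
    where
      rearrange : ∀ s′ d l → s′ + (suc l + d) ≡ d + suc s′ + l
      rearrange = solve-∀
      s≡d+1+s′ : s ≡ d + suc s′
      s≡d+1+s′ = +-cancelʳ-≡ l s (d + suc s′) (trans end≡ (rearrange s′ d l))

  MinUnique-end-injective : MinUnique J s l → MinUnique J s′ l′ → s + l ≡ s′ + l′ → s ≡ s′ × l ≡ l′
  MinUnique-end-injective {l = l} {l′ = l′} mu mu′ end≡ with <-cmp l l′
  ... | tri< l<l′ _ _ = ⊥-elim (Unique-not-suffix-of-repeating (unique mu) (tail-repeats mu′) end≡ l<l′)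
  ... | tri> _ _ l′<l = ⊥-elim (Unique-not-suffix-of-repeating (unique mu′) (tail-repeats mu) (sym end≡) l′<l)
  ... | tri≈ _ refl _ = +-cancelʳ-≡ l _ _ end≡ , refl

  MatchesSuffix : ℕ → ℕ → ℕ → Set
  MatchesSuffix K a L = ∃ λ e → e + L ≡ suc K × Match e a L

  Unique-suffix-of-longer : Unique J a L → Occurs J a L a → Occurs J b (L + d) b →
                            Match e a L → Match e′ b (L + d) → e + L ≡ e′ + (L + d) → a + L ≡ b + (L + d)
  Unique-suffix-of-longer {J} {a} {L} {b} {d} {e} {e′} unique oa ob ma mb end≡ = begin
    a + L        ≡⟨ cong (_+ L) (unique od+b oa) ⟨
    d + b + L    ≡⟨ shuffle d b L ⟩
    b + (L + d)  ∎
    where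
      open ≡-Reasoning
      shuffle : ∀ d b L → d + b + L ≡ b + (L + d)
      shuffle = solve-∀
      e≡d+e′ : e ≡ d + e′
      e≡d+e′ = +-cancelʳ-≡ L e (d + e′) (trans end≡ (sym (shuffle d e′ L)))
      d+L≤L+d : d + L ≤ L + d
      d+L≤L+d = ≤-reflexive (+-comm d L)
      od+b : Occurs J a L (d + b)
      od+b with occurs i≤d+b bound _ ← Occurs-infix ob d d+L≤L+d = occurs i≤d+b bound
        (Match-trans (Match-sym (Match-infix mb d d+L≤L+d)) (subst (λ x → Match x a L) e≡d+e′ ma))

  MatchesSuffix-aligned : ∀ {K} → Unique J a L → Unique J b L′ → Occurs J a L a → Occurs J b L′ b →
                          MatchesSuffix K a L → MatchesSuffix K b L′ → a + L ≡ b + L′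
  MatchesSuffix-aligned {L = L} {L′ = L′} ua ub oa ob (e , e+L≡ , ma) (e′ , e′+L′≡ , mb)
    with ≤-total L L′
  ... | inj₁ L≤L′ with m≤n⇒∃[o]m+o≡n L≤L′
  ...   | d , refl = Unique-suffix-of-longer ua oa ob ma mb (trans e+L≡ (sym e′+L′≡))
  MatchesSuffix-aligned {L = L} {L′ = L′} ua ub oa ob (e , e+L≡ , ma) (e′ , e′+L′≡ , mb)
      | inj₂ L′≤L with m≤n⇒∃[o]m+o≡n L′≤L
  ...   | d , refl = sym (Unique-suffix-of-longer ub ob oa mb ma (trans e′+L′≡ (sym e+L≡)))

  Unique-lost⇒MatchesSuffix : Unique J a L → Occurs J a L a → ¬ Unique (suc J) a L →
                              MatchesSuffix (suc J) a L
  Unique-lost⇒MatchesSuffix {J} {a} {L} unique oa lost with occurs? (suc J) a L (suc (suc J) ∸ L)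
  ... | yes o = suc (suc J) ∸ L , e+L≡2+J , matches o
    where
      e+L≡2+J : suc (suc J) ∸ L + L ≡ suc (suc J)
      e+L≡2+J = m∸n+n≡m (m≤n⇒m≤1+n (m+n≤o⇒n≤o a (right oa)))
  ... | no ¬o = ⊥-elim (lost λ op oq → trans (old op) (sym (old oq)))
    where
      old : Occurs (suc J) a L p → p ≡ a
      old {p} o with Occurs-extend o
      ... | inj₁ o′ = unique o′ oa
      ... | inj₂ p+L≡2+J = ⊥-elim (¬o (subst (Occurs (suc J) a L) p≡2+J∸L o))
        where
          p≡2+J∸L : p ≡ suc (suc J) ∸ L
          p≡2+J∸L = sym (trans (cong (_∸ L) (sym p+L≡2+J)) (m+n∸n≡m p L))

  Repeating-new⇒MatchesSuffix : Repeating (suc J) a L → ¬ Repeating J a L → MatchesSuffix (suc J) a L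
  Repeating-new⇒MatchesSuffix (p , q , p≢q , op , oq) ¬rep with Occurs-extend op | Occurs-extend oq
  ... | inj₂ p+L≡ | _ = p , p+L≡ , matches op
  ... | inj₁ _ | inj₂ q+L≡ = q , q+L≡ , matches oq
  ... | inj₁ op′ | inj₁ oq′ = ⊥-elim (¬rep (p , q , p≢q , op′ , oq′))

  MinUnique-lost⇒MatchesSuffix : MinUnique J s l → ¬ MinUnique (suc J) s l →
                                 MatchesSuffix (suc J) s (suc l)
  MinUnique-lost⇒MatchesSuffix (minUnique i≤s s+l≤J unique tail init) lost =
    Unique-lost⇒MatchesSuffix unique (MinUnique-occurs mu) λ unique′ →
      lost (minUnique i≤s (m≤n⇒m≤1+n s+l≤J) unique′ (Repeating-weaken tail) (Repeating-weaken init))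
    where mu = minUnique i≤s s+l≤J unique tail init

  Unique⇒contains-MinUnique : i ≤ J → ∀ L → Unique J a (suc L) → Occurs J a (suc L) a →
                              ∃₂ λ d l → d + suc l ≤ suc L × MinUnique J (d + a) l
  Unique⇒contains-MinUnique {J} {a} i≤J zero unique oa =
    0 , 0 , ≤-refl ,
    minUnique (left oa) (≤-pred (subst (_≤ suc J) (+-suc a 0) (right oa))) unique
              (Repeating-empty i≤J) (Repeating-empty i≤J)
  Unique⇒contains-MinUnique {J} {a} i≤J (suc L) unique oa
    with repeating? J (suc a) (suc L) | repeating? J a (suc L)
  ... | no ¬tail | _
    with Unique⇒contains-MinUnique i≤J L (¬Repeating⇒Unique ¬tail) (Occurs-infix oa 1 ≤-refl)
  ...   | d , l , bound , mu = suc d , l , s≤s bound , subst (λ s → MinUnique J s l) (+-suc d a) mu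
  Unique⇒contains-MinUnique {J} {a} i≤J (suc L) unique oa
      | yes _ | no ¬init
    with Unique⇒contains-MinUnique i≤J L (¬Repeating⇒Unique ¬init) (Occurs-infix oa 0 (n≤1+n _))
  ...   | d , l , bound , mu = d , l , m≤n⇒m≤1+n bound , mu
  Unique⇒contains-MinUnique {J} {a} i≤J (suc L) unique oa
      | yes tail | yes init =
    0 , suc L , ≤-refl ,
    minUnique (left oa) (≤-pred (subst (_≤ suc J) (+-suc a (suc L)) (right oa))) unique tail init

  Repeating-new⇒lost-MinUnique : i ≤ J → Occurs J a L a → Repeating (suc J) a L → ¬ Repeating J a L →
                                 ∃₂ λ s l → MinUnique J s l × ¬ MinUnique (suc J) s l
  Repeating-new⇒lost-MinUnique {L = zero} i≤J _ _ ¬rep = ⊥-elim (¬rep (Repeating-empty i≤J))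
  Repeating-new⇒lost-MinUnique {J} {a} {suc L} i≤J oa rep ¬rep
    with Repeating-new⇒MatchesSuffix rep ¬rep
       | Unique⇒contains-MinUnique i≤J L (¬Repeating⇒Unique ¬rep) oa
  ... | e , e+L≡2+J , ma | d , l , d+l<L , mu =
    d + a , l , mu , λ mu′ → <-irrefl (unique mu′ o-old o-new) d+a<d+e
    where
      a<e : a < e
      a<e = +-cancelʳ-< (suc L) a e (≤-trans (s≤s (right oa)) (≤-reflexive (sym e+L≡2+J)))
      d+a<d+e : d + a < d + e
      d+a<d+e = +-monoʳ-< d a<e
      o-old : Occurs (suc J) (d + a) (suc l) (d + a)
      o-old = Occurs-weaken (MinUnique-occurs mu)
      o-new : Occurs (suc J) (d + a) (suc l) (d + e)
      o-new = Occurs-infix (occurs (≤-trans (left oa) (<⇒≤ a<e)) (≤-reflexive e+L≡2+J) ma) d d+l<L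

  Repeating-new-end-determined : Occurs J a L a → Repeating (suc J) a L → ¬ Repeating J a L →
                                 Occurs J b L′ b → Repeating (suc J) b L′ → ¬ Repeating J b L′ → a + L ≡ b + L′
  Repeating-new-end-determined oa rep ¬rep ob rep′ ¬rep′ =
    MatchesSuffix-aligned (¬Repeating⇒Unique ¬rep) (¬Repeating⇒Unique ¬rep′) oa ob
      (Repeating-new⇒MatchesSuffix rep ¬rep) (Repeating-new⇒MatchesSuffix rep′ ¬rep′)

  MinUnique-lost-determined : MinUnique J s l → ¬ MinUnique (suc J) s l →
                              MinUnique J s′ l′ → ¬ MinUnique (suc J) s′ l′ → s ≡ s′ × l ≡ l′
  MinUnique-lost-determined {s = s} {l} {s′} {l′} mu lost mu′ lost′ =
    MinUnique-end-injective mu mu′ (suc-injective (begin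
      suc (s + l)    ≡⟨ +-suc s l ⟨
      s + suc l      ≡⟨ MatchesSuffix-aligned (unique mu) (unique mu′) (MinUnique-occurs mu) (MinUnique-occurs mu′)
                          (MinUnique-lost⇒MatchesSuffix mu lost) (MinUnique-lost⇒MatchesSuffix mu′ lost′) ⟩
      s′ + suc l′    ≡⟨ +-suc s′ l′ ⟩
      suc (s′ + l′)  ∎))
    where open ≡-Reasoning

  IsMUS-end-injective : ∀ {J s t s′ t′} → IsMUS T i J (s , t) → IsMUS T i J (s′ , t′) → t ≡ t′ →
                        (s , t) ≡ (s′ , t′)
  IsMUS-end-injective m@(_ , s≤t , _) m′@(_ , s′≤t′ , _) t≡t′ = cong₂ _,_ (proj₁ (MinUnique-end-injective
    (IsMUS⇒MinUnique m) (IsMUS⇒MinUnique m′) (trans (m+[n∸m]≡n s≤t) (trans t≡t′ (sym (m+[n∸m]≡n s′≤t′)))))) t≡t′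

candidates-unique : ∀ n → List.Unique (candidates n)
candidates-unique n = Uniqueₚ.cartesianProduct⁺ (Uniqueₚ.upTo⁺ (suc n)) (Uniqueₚ.upTo⁺ (suc n))

IsMUS⇒∈candidates : ∀ {σ n} {T : Vec (Fin σ) n} {i J s t} → J ≤ n → IsMUS T i J (s , t) →
                    (s , t) ∈ candidates n
IsMUS⇒∈candidates J≤n (_ , s≤t , t≤J , _) =
  ∈-cartesianProduct⁺ (∈-upTo⁺ (s≤s (≤-trans s≤t (≤-trans t≤J J≤n)))) (∈-upTo⁺ (s≤s (≤-trans t≤J J≤n)))

module WindowExtension {σ n : ℕ} (T : Vec (Fin σ) n) (i j : ℕ) (i≤j : i ≤ j) (j<n : j < n) where

  open Occurrences T i

  Old New Kept Removed Added AddedInner AddedAtEnd : ℕ × ℕ → Set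
  Old = IsMUS T i j
  New = IsMUS T i (suc j)
  Kept x = Old x × New x
  Removed x = Old x × ¬ New x
  Added x = New x × ¬ Old x
  AddedInner x = Added x × proj₂ x ≤ j
  AddedAtEnd x = Added x × ¬ proj₂ x ≤ j

  old? : Decidable Old
  old? = isMUS? T i j

  new? : Decidable New
  new? = isMUS? T i (suc j)

  kept? : Decidable Kept
  kept? x = old? x ×-dec new? x

  removed? : Decidable Removed
  removed? x = old? x ×-dec ¬? (new? x)

  added? : Decidable Added
  added? x = new? x ×-dec ¬? (old? x)

  added-inner? : Decidable AddedInner
  added-inner? x = added? x ×-dec (proj₂ x ≤? j)

  added-at-end? : Decidable AddedAtEnd
  added-at-end? x = added? x ×-dec ¬? (proj₂ x ≤? j)

  TailFresh InitFresh : ℕ × ℕ → Set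
  TailFresh (s , t) = AddedInner (s , t) × ¬ Repeating j (suc s) (t ∸ s)
  InitFresh (s , t) = AddedInner (s , t) × ¬ Repeating j s (t ∸ s)

  tail-fresh? : Decidable TailFresh
  tail-fresh? (s , t) = added-inner? (s , t) ×-dec ¬? (repeating? j (suc s) (t ∸ s))

  init-fresh? : Decidable InitFresh
  init-fresh? (s , t) = added-inner? (s , t) ×-dec ¬? (repeating? j s (t ∸ s))

  C : List (ℕ × ℕ)
  C = candidates n

  count-kept≡ : count (λ x → new? x ×-dec old? x) C ≡ count kept? C
  count-kept≡ = count-cong (λ x → new? x ×-dec old? x) kept? (λ (new , old) → old , new) (λ (old , new) → new , old) C

  #MUS-old≡ : #MUS T i j ≡ count kept? C + count removed? C
  #MUS-old≡ = count-split old? new? C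

  #MUS-new≡ : #MUS T i (suc j) ≡ count kept? C + count added? C
  #MUS-new≡ = trans (count-split new? old? C) (cong (_+ count added? C) count-kept≡)

  #SymDiff≡ : #SymDiff T i (suc j) i j ≡ count added? C + count removed? C
  #SymDiff≡ = trans (count-split sd? new? C)
    (cong₂ _+_ (count-cong (λ x → sd? x ×-dec new? x) added? sd∩new⇒added
                           (λ a → inj₁ a , proj₁ a) C)
               (count-cong (λ x → sd? x ×-dec ¬? (new? x)) removed? sd∖new⇒removed
                           (λ (o , ¬n) → inj₂ (¬n , o) , ¬n) C))
    where
      SymDiff : ℕ × ℕ → Set
      SymDiff = InSymDiff T i (suc j) i j
      sd? : Decidable SymDiff
      sd? = inSymDiff? T i (suc j) i j
      sd∩new⇒added : ∀ {x} → SymDiff x × New x → Added x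
      sd∩new⇒added (inj₁ added , _) = added
      sd∩new⇒added (inj₂ (¬new , _) , new) = ⊥-elim (¬new new)
      sd∖new⇒removed : ∀ {x} → SymDiff x × ¬ New x → Removed x
      sd∖new⇒removed (inj₁ (new , _) , ¬new) = ⊥-elim (¬new new)
      sd∖new⇒removed (inj₂ (¬new , old) , _) = old , ¬new

  private
    ends≡ : ∀ {s t s′ t′} → s ≤ t → s′ ≤ t′ → s + (t ∸ s) ≡ s′ + (t′ ∸ s′) → t ≡ t′
    ends≡ s≤t s′≤t′ eq = trans (sym (m+[n∸m]≡n s≤t)) (trans eq (m+[n∸m]≡n s′≤t′))

    ¬IsMUS⇒¬MinUnique : ∀ {J s t} → s ≤ t → ¬ IsMUS T i J (s , t) → ¬ MinUnique J s (t ∸ s)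
    ¬IsMUS⇒¬MinUnique s≤t ¬mus mu = ¬mus (MinUnique⇒IsMUS′ s≤t mu)

  tail-in-window : ∀ {s t} → New (s , t) → t ≤ j → Occurs j (suc s) (t ∸ s) (suc s)
  tail-in-window (i≤s , s≤t , _) t≤j =
    Occurs-self (≤-trans i≤s (n≤1+n _)) (s≤s (≤-trans (≤-reflexive (m+[n∸m]≡n s≤t)) t≤j))

  init-in-window : ∀ {s t} → New (s , t) → t ≤ j → Occurs j s (t ∸ s) s
  init-in-window (i≤s , s≤t , _) t≤j =
    Occurs-self i≤s (≤-trans (≤-reflexive (m+[n∸m]≡n s≤t)) (m≤n⇒m≤1+n t≤j))

  Removed-subsingleton : ∀ {x y} → Removed x → Removed y → x ≡ y
  Removed-subsingleton {s , t} {s′ , t′} (old@(_ , s≤t , _) , ¬new) (old′@(_ , s′≤t′ , _) , ¬new′) =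
    IsMUS-end-injective old old′ (ends≡ s≤t s′≤t′ (cong₂ _+_ (proj₁ same) (proj₂ same)))
    where
      same : s ≡ s′ × t ∸ s ≡ t′ ∸ s′
      same = MinUnique-lost-determined (IsMUS⇒MinUnique old) (¬IsMUS⇒¬MinUnique s≤t ¬new)
                                       (IsMUS⇒MinUnique old′) (¬IsMUS⇒¬MinUnique s′≤t′ ¬new′)

  AddedAtEnd-subsingleton : ∀ {x y} → AddedAtEnd x → AddedAtEnd y → x ≡ y
  AddedAtEnd-subsingleton ((new , _) , t≰j) ((new′ , _) , t′≰j) =
    IsMUS-end-injective new new′ (trans (at-end new t≰j) (sym (at-end new′ t′≰j)))
    where
      at-end : ∀ {s t} → New (s , t) → ¬ t ≤ j → t ≡ suc j
      at-end (_ , _ , t≤1+j , _) t≰j = ≤-antisym t≤1+j (≰⇒> t≰j)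

  TailFresh-subsingleton : ∀ {x y} → TailFresh x → TailFresh y → x ≡ y
  TailFresh-subsingleton {s , t} {s′ , t′} (((new , _) , t≤j) , ¬rep) (((new′ , _) , t′≤j) , ¬rep′) =
    IsMUS-end-injective new new′ (ends≡ (proj₁ (proj₂ new)) (proj₁ (proj₂ new′)) (suc-injective
      (Repeating-new-end-determined
        (tail-in-window new t≤j) (tail-repeats (IsMUS⇒MinUnique new)) ¬rep
        (tail-in-window new′ t′≤j) (tail-repeats (IsMUS⇒MinUnique new′)) ¬rep′)))

  InitFresh-subsingleton : ∀ {x y} → InitFresh x → InitFresh y → x ≡ y
  InitFresh-subsingleton {s , t} {s′ , t′} (((new , _) , t≤j) , ¬rep) (((new′ , _) , t′≤j) , ¬rep′) =
    IsMUS-end-injective new new′ (ends≡ (proj₁ (proj₂ new)) (proj₁ (proj₂ new′))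
      (Repeating-new-end-determined
        (init-in-window new t≤j) (init-repeats (IsMUS⇒MinUnique new)) ¬rep
        (init-in-window new′ t′≤j) (init-repeats (IsMUS⇒MinUnique new′)) ¬rep′))

  AddedInner⇒fresh : ∀ {x} → AddedInner x → TailFresh x ⊎ InitFresh x
  AddedInner⇒fresh {s , t} inner@((new , ¬old) , t≤j)
    with repeating? j (suc s) (t ∸ s) | repeating? j s (t ∸ s)
  ... | no ¬tail | _ = inj₁ (inner , ¬tail)
  ... | yes _ | no ¬init = inj₂ (inner , ¬init)
  ... | yes tail | yes init = ⊥-elim (¬old (MinUnique⇒IsMUS′ s≤t
          (minUnique (left-bound mu) (subst (_≤ j) (sym (m+[n∸m]≡n s≤t)) t≤j)
                     (Unique-strengthen (unique mu)) tail init)))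
    where
      s≤t : s ≤ t
      s≤t = proj₁ (proj₂ new)
      mu : MinUnique (suc j) s (t ∸ s)
      mu = IsMUS⇒MinUnique new

  lost-MinUnique⇒Removed : (∃₂ λ s l → MinUnique j s l × ¬ MinUnique (suc j) s l) → ∃₂ λ s t → Removed (s , t)
  lost-MinUnique⇒Removed (s , l , mu , lost) = s , s + l , MinUnique⇒IsMUS mu , λ new → lost (IsMUS-+⇒MinUnique new)

  AddedInner⇒Removed : ∀ {x} → AddedInner x → ∃₂ λ s t → Removed (s , t)
  AddedInner⇒Removed {s , t} inner = lost-MinUnique⇒Removed (fresh⇒lost (AddedInner⇒fresh inner))
    where
      fresh⇒lost : TailFresh (s , t) ⊎ InitFresh (s , t) → ∃₂ λ s l → MinUnique j s l × ¬ MinUnique (suc j) s l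
      fresh⇒lost (inj₁ (((new , _) , t≤j) , ¬rep)) =
        Repeating-new⇒lost-MinUnique i≤j (tail-in-window new t≤j) (tail-repeats (IsMUS⇒MinUnique new)) ¬rep
      fresh⇒lost (inj₂ (((new , _) , t≤j) , ¬rep)) =
        Repeating-new⇒lost-MinUnique i≤j (init-in-window new t≤j) (init-repeats (IsMUS⇒MinUnique new)) ¬rep

  private
    Added⇒∈C : ∀ {x} → Added x → x ∈ C
    Added⇒∈C {_ , _} (new , _) = IsMUS⇒∈candidates j<n new

    Removed⇒∈C : ∀ {x} → Removed x → x ∈ C
    Removed⇒∈C {_ , _} (old , _) = IsMUS⇒∈candidates (<⇒≤ j<n) old

  count-removed≤1 : count removed? C ≤ 1
  count-removed≤1 = count≤1 removed? (candidates-unique n) Removed-subsingleton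

  count-added≡ : count added? C ≡ count added-inner? C + count added-at-end? C
  count-added≡ = count-split added? (λ x → proj₂ x ≤? j) C

  count-added-inner≤2 : count added-inner? C ≤ 2
  count-added-inner≤2 = ≤-trans (count-union-≤ added-inner? tail-fresh? init-fresh? AddedInner⇒fresh C)
    (+-mono-≤ (count≤1 tail-fresh? (candidates-unique n) TailFresh-subsingleton)
              (count≤1 init-fresh? (candidates-unique n) InitFresh-subsingleton))

  count-added-at-end≤1 : count added-at-end? C ≤ 1
  count-added-at-end≤1 = count≤1 added-at-end? (candidates-unique n) AddedAtEnd-subsingleton

  some-removed⇒1≤count : (∃₂ λ s t → Removed (s , t)) → 1 ≤ count removed? C
  some-removed⇒1≤count (_ , _ , removed) = ∈⇒1≤count removed? (Removed⇒∈C removed) removed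

  count-added-inner⇒count-removed : 1 ≤ count added-inner? C → 1 ≤ count removed? C
  count-added-inner⇒count-removed 1≤inner = some-removed⇒1≤count (inner⇒removed (1≤count⇒∈ added-inner? C 1≤inner))
    where
      inner⇒removed : (∃ λ x → x ∈ C × AddedInner x) → ∃₂ λ s t → Removed (s , t)
      inner⇒removed (_ , _ , inner) = AddedInner⇒Removed inner

  count-added≤count-removed+2 : count added? C ≤ count removed? C + 2
  count-added≤count-removed+2 = subst (_≤ count removed? C + 2) (sym count-added≡)
    (bound count-added-inner≤2 count-added-at-end≤1 count-added-inner⇒count-removed)
    where
      bound : ∀ {a b r} → a ≤ 2 → b ≤ 1 → (1 ≤ a → 1 ≤ r) → a + b ≤ r + 2
      bound {zero} {r = r} _ b≤1 _ = ≤-trans b≤1 (≤-trans (s≤s z≤n) (m≤n+m 2 r))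
      bound {suc a} a≤2 b≤1 a≥1⇒r≥1 = ≤-trans (+-mono-≤ a≤2 b≤1) (+-monoˡ-≤ 2 (a≥1⇒r≥1 (s≤s z≤n)))

  #SymDiff≤4 : #SymDiff T i (suc j) i j ≤ 4
  #SymDiff≤4 = begin
    #SymDiff T i (suc j) i j                   ≡⟨ #SymDiff≡ ⟩
    count added? C + count removed? C          ≤⟨ +-mono-≤ count-added≤count-removed+2 count-removed≤1 ⟩
    count removed? C + 2 + 1                   ≤⟨ +-monoˡ-≤ 1 (+-monoˡ-≤ 2 count-removed≤1) ⟩
    4                                          ∎
    where open ≤-Reasoning

  #MUS-old≤#MUS-new+1 : #MUS T i j ≤ #MUS T i (suc j) + 1
  #MUS-old≤#MUS-new+1 = begin
    #MUS T i j                                 ≡⟨ #MUS-old≡ ⟩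
    count kept? C + count removed? C           ≤⟨ +-monoʳ-≤ (count kept? C) count-removed≤1 ⟩
    count kept? C + 1                          ≤⟨ +-monoˡ-≤ 1 (m≤m+n _ _) ⟩
    count kept? C + count added? C + 1         ≡⟨ cong (_+ 1) #MUS-new≡ ⟨
    #MUS T i (suc j) + 1                       ∎
    where open ≤-Reasoning

  #MUS-new≤#MUS-old+2 : #MUS T i (suc j) ≤ #MUS T i j + 2
  #MUS-new≤#MUS-old+2 = begin
    #MUS T i (suc j)                           ≡⟨ #MUS-new≡ ⟩
    count kept? C + count added? C             ≤⟨ +-monoʳ-≤ (count kept? C) count-added≤count-removed+2 ⟩
    count kept? C + (count removed? C + 2)     ≡⟨ +-assoc (count kept? C) _ 2 ⟨
    count kept? C + count removed? C + 2       ≡⟨ cong (_+ 2) #MUS-old≡ ⟨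
    #MUS T i j + 2                             ∎
    where open ≤-Reasoning

  private
    count-removed≡1 : (∃₂ λ s t → Removed (s , t)) → count removed? C ≡ 1
    count-removed≡1 removed = ≤-antisym count-removed≤1 (some-removed⇒1≤count removed)

  three-added⇒extremal : ∀ {x y z} → AddedInner x → AddedInner y → x ≢ y → AddedAtEnd z →
                         #SymDiff T i (suc j) i j ≡ 4 × #MUS T i (suc j) ≡ #MUS T i j + 2
  three-added⇒extremal x-inner y-inner x≢y z-at-end = #SymDiff≡4 , #MUS-new≡#MUS-old+2
    where
      removed≡1 : count removed? C ≡ 1
      removed≡1 = count-removed≡1 (AddedInner⇒Removed x-inner)
      3≤added : 3 ≤ count added? C
      3≤added = subst (3 ≤_) (sym count-added≡) (+-mono-≤
        (distinct⇒2≤count added-inner? (Added⇒∈C (proj₁ x-inner)) (Added⇒∈C (proj₁ y-inner))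
                          x≢y x-inner y-inner)
        (∈⇒1≤count added-at-end? (Added⇒∈C (proj₁ z-at-end)) z-at-end))
      added≡3 : count added? C ≡ 3
      added≡3 = ≤-antisym (subst (λ r → count added? C ≤ r + 2) removed≡1 count-added≤count-removed+2) 3≤added
      #SymDiff≡4 : #SymDiff T i (suc j) i j ≡ 4
      #SymDiff≡4 = trans #SymDiff≡ (cong₂ _+_ added≡3 removed≡1)
      #MUS-new≡#MUS-old+2 : #MUS T i (suc j) ≡ #MUS T i j + 2
      #MUS-new≡#MUS-old+2 = begin
        #MUS T i (suc j)                   ≡⟨ #MUS-new≡ ⟩
        count kept? C + count added? C     ≡⟨ cong (count kept? C +_) added≡3 ⟩
        count kept? C + (1 + 2)            ≡⟨ +-assoc (count kept? C) 1 2 ⟨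
        count kept? C + 1 + 2              ≡⟨ cong (λ r → count kept? C + r + 2) removed≡1 ⟨
        count kept? C + count removed? C + 2 ≡⟨ cong (_+ 2) #MUS-old≡ ⟨
        #MUS T i j + 2                     ∎
        where open ≡-Reasoning

  none-added⇒decrease : (∀ {x} → ¬ Added x) → ∀ {x} → Removed x → #MUS T i j ≡ #MUS T i (suc j) + 1
  none-added⇒decrease ¬added {_ , _} removed = begin
    #MUS T i j                          ≡⟨ #MUS-old≡ ⟩
    count kept? C + count removed? C    ≡⟨ cong (count kept? C +_) (count-removed≡1 (_ , _ , removed)) ⟩
    count kept? C + 1                   ≡⟨ cong (_+ 1) (+-identityʳ _) ⟨
    count kept? C + 0 + 1               ≡⟨ cong (λ a → count kept? C + a + 1) (count≡0 added? ¬added C) ⟨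
    count kept? C + count added? C + 1  ≡⟨ cong (_+ 1) #MUS-new≡ ⟨
    #MUS T i (suc j) + 1                ∎
    where open ≡-Reasoning

module Words {σ : ℕ} (n : ℕ) (f : ℕ → Fin σ) where

  word : Vec (Fin σ) n
  word = tabulate (λ q → f (suc (toℕ q)))

  at-word : ∀ {q} → 1 ≤ q → q ≤ n → at word q ≡ just (f q)
  at-word {suc q} _ q<n with q <? n
  ... | yes q<n′ = cong just (trans (lookup∘tabulate _ (fromℕ< q<n′)) (cong (f ∘ suc) (toℕ-fromℕ< q<n′)))
  ... | no q≮n = contradiction q<n q≮n

  -- Offsets are added on the left so that the first two positions reduce: Agree p a 2 yields
  -- f p ≡ f a and f (suc p) ≡ f (suc a) without arithmetic.
  Agree : ℕ → ℕ → ℕ → Set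
  Agree p a L = ∀ k → k < L → f (k + p) ≡ f (k + a)

  module _ (i : ℕ) (1≤i : 1 ≤ i) where
    open Occurrences word i

    private
      at-word-inside : ∀ {p L k} → i ≤ p → p + L ≤ suc n → k < L → at word (p + k) ≡ just (f (k + p))
      at-word-inside {p} {L} {k} i≤p bound k<L =
        trans (at-word (≤-trans 1≤i (≤-trans i≤p (m≤m+n p k)))
                       (≤-pred (≤-trans (≤-reflexive (sym (+-suc p k))) (≤-trans (+-monoʳ-≤ p k<L) bound))))
              (cong (just ∘ f) (+-comm p k))

    Match⇒Agree : ∀ {p a L} → i ≤ p → p + L ≤ suc n → i ≤ a → a + L ≤ suc n → Match p a L → Agree p a L
    Match⇒Agree i≤p p-bound i≤a a-bound m k k<L = just-injective (trans (sym (at-word-inside i≤p p-bound k<L))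
      (trans (agree m k k<L) (at-word-inside i≤a a-bound k<L)))

    Agree⇒Match : ∀ {p a L} → i ≤ p → p + L ≤ suc n → i ≤ a → a + L ≤ suc n → Agree p a L → Match p a L
    Agree⇒Match i≤p p-bound i≤a a-bound ag = match λ k k<L → trans (at-word-inside i≤p p-bound k<L)
      (trans (cong just (ag k k<L)) (sym (at-word-inside i≤a a-bound k<L)))

    Occurs⇒Agree : ∀ {J a L p} → J ≤ n → i ≤ a → a + L ≤ suc J → Occurs J a L p → Agree p a L
    Occurs⇒Agree J≤n i≤a a-bound (occurs i≤p p-bound m) =
      Match⇒Agree i≤p (≤-trans p-bound (s≤s J≤n)) i≤a (≤-trans a-bound (s≤s J≤n)) m

    Agree⇒Occurs : ∀ {J a L p} → J ≤ n → i ≤ p → p + L ≤ suc J → i ≤ a → a + L ≤ suc J →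
                   Agree p a L → Occurs J a L p
    Agree⇒Occurs J≤n i≤p p-bound i≤a a-bound ag =
      occurs i≤p p-bound (Agree⇒Match i≤p (≤-trans p-bound (s≤s J≤n)) i≤a (≤-trans a-bound (s≤s J≤n)) ag)

    letter-Occurs : ∀ {J a p} → J ≤ n → i ≤ p → p ≤ J → i ≤ a → a ≤ J → f p ≡ f a → Occurs J a 1 p
    letter-Occurs {p = p} J≤n i≤p p≤J i≤a a≤J fp≡fa =
      Agree⇒Occurs J≤n i≤p (+-comm-bound p≤J) i≤a (+-comm-bound a≤J) λ { zero _ → fp≡fa ; (suc _) (s≤s ()) }
      where
        +-comm-bound : ∀ {x J} → x ≤ J → x + 1 ≤ suc J
        +-comm-bound {x} {J} x≤J = subst (_≤ suc J) (+-comm 1 x) (s≤s x≤J)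

    letter-Repeating : ∀ {J p q} → J ≤ n → p ≢ q → i ≤ p → p ≤ J → i ≤ q → q ≤ J → f p ≡ f q →
                       Repeating J p 1
    letter-Repeating J≤n p≢q i≤p p≤J i≤q q≤J fp≡fq = _ , _ , p≢q ,
      letter-Occurs J≤n i≤p p≤J i≤p p≤J refl , letter-Occurs J≤n i≤q q≤J i≤p p≤J (sym fp≡fq)

module ThreeAdded (σ′ n i c : ℕ) (1≤i : 1 ≤ i) (i<c : i < c) (j<n : 3 + c < n) where

  x₀ x₁ x₂ : Fin (3 + σ′)
  x₀ = fzero
  x₁ = fsuc fzero
  x₂ = fsuc (fsuc fzero)

  block : ℕ → Fin (3 + σ′)
  block 1 = x₁
  block 2 = x₂
  block 3 = x₂
  block 4 = x₁
  block _ = x₀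

  f : ℕ → Fin (3 + σ′)
  f q = block (q ∸ c)

  j : ℕ
  j = 3 + c

  open Words n f
  open Occurrences word i
  open WindowExtension word i j (≤-trans (<⇒≤ i<c) (m≤n+m c 3)) j<n

  f-block : ∀ k → f (k + c) ≡ block k
  f-block k = cong block (m+n∸n≡m k c)

  f-prefix : ∀ {q} → q ≤ c → f q ≡ x₀
  f-prefix q≤c = cong block (m≤n⇒m∸n≡0 q≤c)

  private
    in-block : ∀ {q d} → q ∸ c ≡ suc d → q ≡ suc d + c
    in-block {q} q∸c≡1+d = trans (sym (m∸n+n≡m c≤q)) (cong (_+ c) q∸c≡1+d)
      where
        c≤q : c ≤ q
        c≤q = <⇒≤ (m∸n≢0⇒n<m {q} {c} λ q∸c≡0 → 0≢1+n (trans (sym q∸c≡0) q∸c≡1+d))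

  f≡x₁ : ∀ {q} → f q ≡ x₁ → q ≡ 1 + c ⊎ q ≡ 4 + c
  f≡x₁ {q} fq≡x₁ with q ∸ c in eq
  ... | 1 = inj₁ (in-block eq)
  ... | 4 = inj₂ (in-block eq)
  f≡x₁ () | 0
  f≡x₁ () | 2
  f≡x₁ () | 3
  f≡x₁ () | suc (suc (suc (suc (suc _))))

  f≡x₂ : ∀ {q} → f q ≡ x₂ → q ≡ 2 + c ⊎ q ≡ 3 + c
  f≡x₂ {q} fq≡x₂ with q ∸ c in eq
  ... | 2 = inj₁ (in-block eq)
  ... | 3 = inj₂ (in-block eq)
  f≡x₂ () | 0
  f≡x₂ () | 1
  f≡x₂ () | 4
  f≡x₂ () | suc (suc (suc (suc (suc _))))

  private
    J′≤n : suc j ≤ n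
    J′≤n = j<n

    i≤ : ∀ k → i ≤ k + c
    i≤ k = ≤-trans (<⇒≤ i<c) (m≤n+m c k)

    ≤J′ : ∀ k → {True (k ≤? 4)} → k + c ≤ 4 + c
    ≤J′ k {k≤4} = +-monoˡ-≤ c (toWitness k≤4)

    bound : ∀ k L m → {True (k + L ≤? m)} → k + c + L ≤ m + c
    bound k L m {k+L≤m} = subst (_≤ m + c) (shuffle k L c) (+-monoˡ-≤ c (toWitness k+L≤m))
      where
        shuffle : ∀ k L c → k + L + c ≡ k + c + L
        shuffle = solve-∀

    pair-agree : ∀ k → {True (k + 2 ≤? 5)} → ∀ {p} → Occurs (suc j) (k + c) 2 p →
                 f p ≡ f (k + c) × f (suc p) ≡ f (suc k + c)
    pair-agree k {k+2≤5} o = ag 0 (s≤s z≤n) , ag 1 (s≤s (s≤s z≤n))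
      where
        ag : Agree _ (k + c) 2
        ag = Occurs⇒Agree i 1≤i J′≤n (i≤ k) (bound k 2 5 {k+2≤5}) o

  x₀x₁-unique : Unique (suc j) c 2
  x₀x₁-unique = pinned⇒Unique pinned
    where
      pinned : ∀ {p} → Occurs (suc j) c 2 p → p ≡ c
      pinned o with pair-agree 0 o
      ... | fp≡x₀ , f1+p≡x₁ with f≡x₁ (trans f1+p≡x₁ (f-block 1))
      ...   | inj₁ 1+p≡1+c = suc-injective 1+p≡1+c
      ...   | inj₂ refl with () ← trans (sym (f-block 3)) (trans fp≡x₀ (f-prefix ≤-refl))

  x₁x₂-unique : Unique (suc j) (1 + c) 2
  x₁x₂-unique = pinned⇒Unique pinned
    where
      pinned : ∀ {p} → Occurs (suc j) (1 + c) 2 p → p ≡ 1 + c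
      pinned o with f≡x₁ (trans (proj₁ (pair-agree 1 o)) (f-block 1))
      ... | inj₁ p≡1+c = p≡1+c
      ... | inj₂ refl = ⊥-elim (1+n≰n (subst (_≤ 5 + c) (+-comm (4 + c) 2) (right o)))

  x₂x₁-unique : Unique (suc j) (3 + c) 2
  x₂x₁-unique = pinned⇒Unique pinned
    where
      pinned : ∀ {p} → Occurs (suc j) (3 + c) 2 p → p ≡ 3 + c
      pinned o with pair-agree 3 o
      ... | fp≡x₂ , f1+p≡x₁ with f≡x₂ (trans fp≡x₂ (f-block 3))
      ...   | inj₂ p≡3+c = p≡3+c
      ...   | inj₁ refl with () ← trans (sym (f-block 3)) (trans f1+p≡x₁ (f-block 4))

  x₁-not-repeating : ¬ Repeating j (1 + c) 1
  x₁-not-repeating = Unique⇒¬Repeating (pinned⇒Unique pinned)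
    where
      pinned : ∀ {p} → Occurs j (1 + c) 1 p → p ≡ 1 + c
      pinned o
        with f≡x₁ (trans (Occurs⇒Agree i 1≤i (<⇒≤ j<n) (i≤ 1) (bound 1 1 4) o 0 (s≤s z≤n)) (f-block 1))
      ... | inj₁ p≡1+c = p≡1+c
      ... | inj₂ refl = ⊥-elim (1+n≰n (subst (_≤ 4 + c) (+-comm (4 + c) 1) (right o)))

  private
    letter-repeats : ∀ k l → {True (k ≤? 4)} → {True (l ≤? 4)} → k ≢ l → block k ≡ block l →
                     Repeating (suc j) (k + c) 1
    letter-repeats k l {k≤4} {l≤4} k≢l same-letter = letter-Repeating i 1≤i J′≤n (λ eq → k≢l (+-cancelʳ-≡ c k l eq))
      (i≤ k) (≤J′ k {k≤4}) (i≤ l) (≤J′ l {l≤4}) (trans (f-block k) (trans same-letter (sym (f-block l))))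

    x₀-repeats : Repeating (suc j) c 1
    x₀-repeats = letter-Repeating i 1≤i J′≤n (>⇒≢ i<c) (<⇒≤ i<c) (≤J′ 0) ≤-refl (≤-trans (<⇒≤ i<c) (≤J′ 0))
      (trans (f-prefix ≤-refl) (sym (f-prefix (<⇒≤ i<c))))

  x₀x₁-MinUnique : MinUnique (suc j) c 1
  x₀x₁-MinUnique = minUnique (<⇒≤ i<c) (bound 0 1 4) x₀x₁-unique (letter-repeats 1 4 (λ ()) refl) x₀-repeats

  x₁x₂-MinUnique : MinUnique (suc j) (1 + c) 1
  x₁x₂-MinUnique =
    minUnique (i≤ 1) (bound 1 1 4) x₁x₂-unique (letter-repeats 2 3 (λ ()) refl) (letter-repeats 1 4 (λ ()) refl)

  x₂x₁-MinUnique : MinUnique (suc j) (3 + c) 1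
  x₂x₁-MinUnique =
    minUnique (i≤ 3) (bound 3 1 4) x₂x₁-unique (letter-repeats 4 1 (λ ()) refl) (letter-repeats 3 2 (λ ()) refl)

  x₀x₁-added : AddedInner (c , c + 1)
  x₀x₁-added =
    (MinUnique⇒IsMUS x₀x₁-MinUnique , λ old → x₁-not-repeating (tail-repeats (IsMUS-+⇒MinUnique old))) ,
    bound 0 1 3

  x₁x₂-added : AddedInner (1 + c , 1 + c + 1)
  x₁x₂-added =
    (MinUnique⇒IsMUS x₁x₂-MinUnique , λ old → x₁-not-repeating (init-repeats (IsMUS-+⇒MinUnique old))) ,
    bound 1 1 3

  x₂x₁-added : AddedAtEnd (3 + c , 3 + c + 1)
  x₂x₁-added = (MinUnique⇒IsMUS x₂x₁-MinUnique , λ (_ , _ , t≤j , _) → outside t≤j) , outside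
    where
      outside : ¬ 3 + c + 1 ≤ j
      outside t≤j = 1+n≰n (subst (_≤ j) (+-comm (3 + c) 1) t≤j)

  extremal : #SymDiff word i (suc j) i j ≡ 4 × #MUS word i (suc j) ≡ #MUS word i j + 2
  extremal = three-added⇒extremal x₀x₁-added x₁x₂-added
    (λ c≡1+c → 1+n≰n (≤-reflexive (sym (cong proj₁ c≡1+c)))) x₂x₁-added

module OneRemoved (σ′ n i e : ℕ) (1≤i : 1 ≤ i) (3+i≤e : 3 + i ≤ e) (j<n : suc e < n) where

  x₀ x₁ : Fin (3 + σ′)
  x₀ = fzero
  x₁ = fsuc fzero

  f : ℕ → Fin (3 + σ′)
  f q with q <? 2 + i | q ≤? e
  ... | yes _ | _     = x₀
  ... | no _  | yes _ = x₁
  ... | no _  | no _  = x₀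

  j : ℕ
  j = suc e

  f-left : ∀ {q} → q < 2 + i → f q ≡ x₀
  f-left {q} q<2+i with q <? 2 + i
  ... | yes _ = refl
  ... | no q≮2+i = contradiction q<2+i q≮2+i

  f-middle : ∀ {q} → 2 + i ≤ q → q ≤ e → f q ≡ x₁
  f-middle {q} 2+i≤q q≤e with q <? 2 + i | q ≤? e
  ... | yes q<2+i | _ = contradiction 2+i≤q (<⇒≱ q<2+i)
  ... | no _ | yes _ = refl
  ... | no _ | no q≰e = contradiction q≤e q≰e

  f-right : ∀ {q} → e < q → f q ≡ x₀
  f-right {q} e<q with q <? 2 + i | q ≤? e
  ... | yes _ | _ = refl
  ... | no _ | yes q≤e = contradiction q≤e (<⇒≱ e<q)
  ... | no _ | no _ = refl

  f≡x₀ : ∀ {q} → f q ≡ x₀ → q < 2 + i ⊎ e < q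
  f≡x₀ {q} fq≡x₀ with q <? 2 + i | q ≤? e
  ... | yes q<2+i | _ = inj₁ q<2+i
  ... | no _ | no q≰e = inj₂ (≰⇒> q≰e)
  f≡x₀ () | no _ | yes _

  f≡x₁ : ∀ {q} → f q ≡ x₁ → 2 + i ≤ q × q ≤ e
  f≡x₁ {q} fq≡x₁ with q <? 2 + i | q ≤? e
  ... | no q≮2+i | yes q≤e = ≮⇒≥ q≮2+i , q≤e
  f≡x₁ () | yes _ | _
  f≡x₁ () | no _ | no _

  x₁x₀-only-at-e : ∀ {q} → f q ≡ x₁ → f (suc q) ≡ x₀ → q ≡ e
  x₁x₀-only-at-e fq≡x₁ f1+q≡x₀ with f≡x₁ fq≡x₁ | f≡x₀ f1+q≡x₀
  ... | 2+i≤q , _ | inj₁ 1+q<2+i = contradiction (≤-trans 2+i≤q (n≤1+n _)) (<⇒≱ 1+q<2+i)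
  ... | _ , q≤e | inj₂ e<1+q = ≤-antisym q≤e (≤-pred e<1+q)

  x₀x₁-only-at-1+i : ∀ {q} → f q ≡ x₀ → f (suc q) ≡ x₁ → q ≡ suc i
  x₀x₁-only-at-1+i fq≡x₀ f1+q≡x₁ with f≡x₁ f1+q≡x₁ | f≡x₀ fq≡x₀
  ... | 2+i≤1+q , _ | inj₁ q<2+i = ≤-antisym (≤-pred q<2+i) (≤-pred 2+i≤1+q)
  ... | _ , 1+q≤e | inj₂ e<q = ⊥-elim (<-asym e<q 1+q≤e)

  x₀x₀-only-at-i : ∀ {q} → i ≤ q → q ≤ e → f q ≡ x₀ → f (suc q) ≡ x₀ → q ≡ i
  x₀x₀-only-at-i {q} i≤q q≤e fq≡x₀ f1+q≡x₀ with f≡x₀ f1+q≡x₀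
  ... | inj₁ 1+q<2+i = ≤-antisym (≤-pred (≤-pred 1+q<2+i)) i≤q
  ... | inj₂ e<1+q =
    contradiction (trans (sym fq≡x₀) (f-middle (≤-trans (≤-trans (n≤1+n _) 3+i≤e) (≤-pred e<1+q)) q≤e)) λ ()

  open Words n f
  open Occurrences word i
  open WindowExtension word i j (≤-trans (≤-trans (m≤n+m i 3) 3+i≤e) (n≤1+n e)) j<n

  private
    i<e : i < e
    i<e = ≤-trans (m≤n+m (suc i) 2) 3+i≤e

    f-i : f i ≡ x₀
    f-i = f-left (s≤s (n≤1+n i))

    f-1+i : f (suc i) ≡ x₀
    f-1+i = f-left ≤-refl

    f-e : f e ≡ x₁
    f-e = f-middle (≤-trans (n≤1+n _) 3+i≤e) ≤-refl

    f-1+e : f (suc e) ≡ x₀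
    f-1+e = f-right ≤-refl

    f-2+e : f (suc (suc e)) ≡ x₀
    f-2+e = f-right (n≤1+n _)

    x₀x₀-bound : ∀ {J} → e ≤ J → i + 2 ≤ suc J
    x₀x₀-bound {J} e≤J = subst (_≤ suc J) (+-comm 2 i) (s≤s (≤-trans i<e e≤J))

  x₀x₀-MinUnique : MinUnique j i 1
  x₀x₀-MinUnique = minUnique ≤-refl (subst (_≤ j) (+-comm 1 i) 1+i≤j) (pinned⇒Unique pinned)
    (letter-Repeating i 1≤i (<⇒≤ j<n) (>⇒≢ (n<1+n i)) (n≤1+n i) 1+i≤j ≤-refl i≤j (trans f-1+i (sym f-i)))
    (letter-Repeating i 1≤i (<⇒≤ j<n) (<⇒≢ (n<1+n i)) ≤-refl i≤j (n≤1+n i) 1+i≤j (trans f-i (sym f-1+i)))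
    where
      1+i≤j : suc i ≤ j
      1+i≤j = s≤s (<⇒≤ i<e)
      i≤j : i ≤ j
      i≤j = ≤-trans (n≤1+n i) 1+i≤j
      pinned : ∀ {p} → Occurs j i 2 p → p ≡ i
      pinned {p} o = x₀x₀-only-at-i (left o) (≤-pred (≤-pred (subst (_≤ suc j) (+-comm p 2) (right o))))
        (trans (ag 0 (s≤s z≤n)) f-i) (trans (ag 1 (s≤s (s≤s z≤n))) f-1+i)
        where
          ag : Agree p i 2
          ag = Occurs⇒Agree i 1≤i (<⇒≤ j<n) ≤-refl (x₀x₀-bound (n≤1+n e)) o

  x₀x₀-lost : ¬ MinUnique (suc j) i 1
  x₀x₀-lost mu = <-irrefl (unique mu (MinUnique-occurs mu) o) (≤-trans i<e (n≤1+n e))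
    where
      ag : Agree (suc e) i 2
      ag zero _ = trans f-1+e (sym f-i)
      ag (suc zero) _ = trans f-2+e (sym f-1+i)
      ag (suc (suc _)) (s≤s (s≤s ()))
      o : Occurs (suc j) i 2 (suc e)
      o = Agree⇒Occurs i 1≤i j<n (≤-trans (<⇒≤ i<e) (n≤1+n e)) (≤-reflexive (+-comm (suc e) 2)) ≤-refl
            (x₀x₀-bound (≤-trans (n≤1+n e) (n≤1+n _))) ag

  private
    i≤j : i ≤ j
    i≤j = ≤-trans (<⇒≤ i<e) (n≤1+n e)

    suffix-agree : ∀ {a L} → Occurs j a L a → MatchesSuffix (suc j) a L →
                   ∃ λ e′ → e′ + L ≡ 3 + e × Agree e′ a L
    suffix-agree {a} {L} oa (e′ , e′+L≡3+e , m) = e′ , e′+L≡3+e ,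
      Match⇒Agree i 1≤i (≤-trans (left oa) (<⇒≤ a<e′)) (≤-trans (≤-reflexive e′+L≡3+e) (s≤s j<n))
                        (left oa) (≤-trans (right oa) (s≤s (<⇒≤ j<n))) m
      where
        a<e′ : a < e′
        a<e′ = +-cancelʳ-< L a e′ (≤-trans (s≤s (right oa)) (≤-reflexive (sym e′+L≡3+e)))

  unique-suffix⇒x₀x₀ : ∀ {a L e′} → Occurs j a L a → Unique j a L → e′ + L ≡ 3 + e → Agree e′ a L →
                       a ≡ i × L ≡ 2
  unique-suffix⇒x₀x₀ {L = 0} _ unique _ _ = ⊥-elim (Unique⇒¬Repeating unique (Repeating-empty i≤j))
  unique-suffix⇒x₀x₀ {a} {1} {e′} oa unique e′+1≡3+e ag =
    ⊥-elim (Unique⇒¬Repeating unique (i , suc i , <⇒≢ (n<1+n i) ,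
    letter-Occurs i 1≤i (<⇒≤ j<n) ≤-refl i≤j (left oa) a≤j (trans f-i (sym fa≡x₀)) ,
    letter-Occurs i 1≤i (<⇒≤ j<n) (n≤1+n i) (s≤s (<⇒≤ i<e)) (left oa) a≤j (trans f-1+i (sym fa≡x₀))))
    where
      a≤j : a ≤ j
      a≤j = ≤-pred (subst (_≤ suc j) (+-comm a 1) (right oa))
      fa≡x₀ : f a ≡ x₀
      fa≡x₀ = trans (sym (ag 0 (s≤s z≤n))) (trans (cong f (suc-injective (trans (+-comm 1 e′) e′+1≡3+e))) f-2+e)
  unique-suffix⇒x₀x₀ {a} {2} {e′} oa unique e′+2≡3+e ag = unique oa oi , refl
    where
      e′≡1+e : e′ ≡ suc e
      e′≡1+e = suc-injective (suc-injective (trans (+-comm 2 e′) e′+2≡3+e))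
      ag′ : Agree i a 2
      ag′ zero _ = trans f-i (trans (sym f-1+e) (trans (cong f (sym e′≡1+e)) (ag 0 (s≤s z≤n))))
      ag′ (suc zero) _ =
        trans f-1+i (trans (sym f-2+e) (trans (cong (f ∘ suc) (sym e′≡1+e)) (ag 1 (s≤s (s≤s z≤n)))))
      ag′ (suc (suc _)) (s≤s (s≤s ()))
      oi : Occurs j a 2 i
      oi = Agree⇒Occurs i 1≤i (<⇒≤ j<n) ≤-refl (x₀x₀-bound (n≤1+n e)) (left oa) (right oa) ag′
  unique-suffix⇒x₀x₀ {a} {suc (suc (suc d))} {e′} oa _ e′+L≡3+e ag = ⊥-elim (1+n≰n (begin
    suc (suc (suc e))      ≡⟨ cong (3 +_) d+a≡e ⟨
    3 + (d + a)            ≡⟨ rearrange a d ⟩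
    a + (3 + d)            ≤⟨ right oa ⟩
    suc (suc e)            ∎))
    where
      open ≤-Reasoning
      rearrange : ∀ a d → 3 + (d + a) ≡ a + (3 + d)
      rearrange = solve-∀
      d+e′≡e : d + e′ ≡ e
      d+e′≡e = +-cancelˡ-≡ 3 _ _ (trans (rearrange e′ d) e′+L≡3+e)
      d+a≡e : d + a ≡ e
      d+a≡e = x₁x₀-only-at-e
        (trans (sym (ag d (m≤n+m (suc d) 2))) (trans (cong f d+e′≡e) f-e))
        (trans (sym (ag (suc d) (m≤n+m (2 + d) 1))) (trans (cong (f ∘ suc) d+e′≡e) f-1+e))

  fresh⇒x₀x₀ : ∀ {a L} → Occurs j a L a → Repeating (suc j) a L → ¬ Repeating j a L → a ≡ i × L ≡ 2
  fresh⇒x₀x₀ oa rep ¬rep with e′ , e′+L≡3+e , ag ← suffix-agree oa (Repeating-new⇒MatchesSuffix rep ¬rep) =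
    unique-suffix⇒x₀x₀ oa (¬Repeating⇒Unique ¬rep) e′+L≡3+e ag

  no-MinUnique-at-end : ∀ {s l} → MinUnique (suc j) s l → s + l ≡ suc j → ⊥
  no-MinUnique-at-end {s} {zero} mu s+0≡2+e = <-irrefl (unique mu o-i (MinUnique-occurs mu)) i<s
    where
      s≡2+e = trans (sym (+-identityʳ s)) s+0≡2+e
      i<s = subst (i <_) (sym s≡2+e) (≤-trans i<e (≤-trans (n≤1+n e) (n≤1+n _)))
      o-i : Occurs (suc j) s 1 i
      o-i = letter-Occurs i 1≤i j<n ≤-refl (≤-trans i≤j (n≤1+n j)) (left-bound mu) (≤-reflexive s≡2+e)
              (trans f-i (sym (trans (cong f s≡2+e) f-2+e)))
  no-MinUnique-at-end {s} {suc zero} mu s+1≡2+e = <-irrefl (unique mu o-i (MinUnique-occurs mu)) i<s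
    where
      s≡1+e = suc-injective (trans (+-comm 1 s) s+1≡2+e)
      i<s = subst (i <_) (sym s≡1+e) (≤-trans i<e (n≤1+n e))
      ag : Agree i s 2
      ag zero _ = trans f-i (sym (trans (cong f s≡1+e) f-1+e))
      ag (suc zero) _ = trans f-1+i (sym (trans (cong (f ∘ suc) s≡1+e) f-2+e))
      ag (suc (suc _)) (s≤s (s≤s ()))
      o-i : Occurs (suc j) s 2 i
      o-i = Agree⇒Occurs i 1≤i j<n ≤-refl (x₀x₀-bound (≤-trans (n≤1+n e) (n≤1+n _))) (left-bound mu)
              (≤-trans (≤-reflexive (trans (+-comm s 2) (cong (2 +_) s≡1+e))) ≤-refl) ag
  no-MinUnique-at-end {s} {suc (suc d)} mu s+l≡2+e = Unique⇒¬Repeating (pinned⇒Unique pinned) (init-repeats mu)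
    where
      rearrange : ∀ s d → s + (2 + d) ≡ 2 + (d + s)
      rearrange = solve-∀
      d+s≡e : d + s ≡ e
      d+s≡e = +-cancelˡ-≡ 2 _ _ (trans (sym (rearrange s d)) s+l≡2+e)
      pinned : ∀ {p} → Occurs (suc j) s (2 + d) p → p ≡ s
      pinned o = +-cancelˡ-≡ d _ _ (trans (x₁x₀-only-at-e
          (trans (ag d (m≤n+m (suc d) 1)) (trans (cong f d+s≡e) f-e))
          (trans (ag (suc d) ≤-refl) (trans (cong (f ∘ suc) d+s≡e) f-1+e))) (sym d+s≡e))
        where
          ag = Occurs⇒Agree i 1≤i j<n (left-bound mu) (≤-trans (≤-reflexive s+l≡2+e) (n≤1+n _)) o

  x₀x₁-not-repeating : ¬ Repeating (suc j) (suc i) 2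
  x₀x₁-not-repeating = Unique⇒¬Repeating (pinned⇒Unique pinned)
    where
      pinned : ∀ {p} → Occurs (suc j) (suc i) 2 p → p ≡ suc i
      pinned o = x₀x₁-only-at-1+i (trans (ag 0 (s≤s z≤n)) f-1+i)
                                   (trans (ag 1 (s≤s (s≤s z≤n))) (f-middle ≤-refl (≤-trans (n≤1+n _) 3+i≤e)))
        where
          ag = Occurs⇒Agree i 1≤i j<n (n≤1+n i)
                 (subst (_≤ 3 + e) (+-comm 2 (suc i)) (s≤s (s≤s (s≤s (<⇒≤ i<e))))) o

  nothing-added : ∀ {x} → ¬ Added x
  nothing-added {s , t} added@(new@(_ , s≤t , t≤1+j , _) , _) = by-end (t ≤? j)
    where
      mu : MinUnique (suc j) s (t ∸ s)
      mu = IsMUS⇒MinUnique new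
      by-fresh : TailFresh (s , t) ⊎ InitFresh (s , t) → ⊥
      by-fresh (inj₁ ((_ , t≤j) , ¬tail)) =
        1+n≰n (subst (_≤ s) (sym (proj₁ (fresh⇒x₀x₀ (tail-in-window new t≤j) (tail-repeats mu) ¬tail))) (left-bound mu))
      by-fresh (inj₂ ((_ , t≤j) , ¬init)) = x₀x₁-not-repeating
        (subst₂ (λ a L → Repeating (suc j) (suc a) L) (proj₁ x₀x₀) (proj₂ x₀x₀) (tail-repeats mu))
        where
          x₀x₀ : s ≡ i × t ∸ s ≡ 2
          x₀x₀ = fresh⇒x₀x₀ (init-in-window new t≤j) (init-repeats mu) ¬init
      by-end : Dec (t ≤ j) → ⊥
      by-end (yes t≤j) = by-fresh (AddedInner⇒fresh (added , t≤j))
      by-end (no t≰j) = no-MinUnique-at-end mu (trans (m+[n∸m]≡n s≤t) (≤-antisym t≤1+j (≰⇒> t≰j)))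

  decrease : #MUS word i j ≡ #MUS word i (suc j) + 1
  decrease = none-added⇒decrease nothing-added
    (MinUnique⇒IsMUS x₀x₀-MinUnique , λ new → x₀x₀-lost (IsMUS-+⇒MinUnique new))

theorem1 :
    -- upper/lower bounds, alphabet size σ ≥ 2
    ((σ : ℕ) → 2 ≤ σ → (n : ℕ) → (T : Vec (Fin σ) n) → (i j : ℕ) →
      1 ≤ i → i ≤ j → j < n →
        (#SymDiff T i (suc j) i j ≤ 4)
        × ((#MUS T i j ≤ #MUS T i (suc j) + 1)
        × (#MUS T i (suc j) ≤ #MUS T i j + 2)))
    ×
    -- tightness, alphabet size σ ≥ 3, window length j - i + 1 ≥ 5
    ((σ : ℕ) → 3 ≤ σ → (n i j : ℕ) →
      1 ≤ i → i ≤ j → j < n → 5 ≤ suc j ∸ i →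
        (∃ λ (T : Vec (Fin σ) n) → #SymDiff T i (suc j) i j ≡ 4)
        × ((∃ λ (T : Vec (Fin σ) n) → #MUS T i (suc j) ≡ #MUS T i j + 2)
        × (∃ λ (T : Vec (Fin σ) n) → #MUS T i j ≡ #MUS T i (suc j) + 1)))
theorem1 = bounds , tightness
  where
    bounds : (σ : ℕ) → 2 ≤ σ → (n : ℕ) → (T : Vec (Fin σ) n) → (i j : ℕ) → 1 ≤ i → i ≤ j → j < n →
             (#SymDiff T i (suc j) i j ≤ 4)
             × ((#MUS T i j ≤ #MUS T i (suc j) + 1) × (#MUS T i (suc j) ≤ #MUS T i j + 2))
    bounds _ _ _ T i j _ i≤j j<n = #SymDiff≤4 , #MUS-old≤#MUS-new+1 , #MUS-new≤#MUS-old+2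
      where open WindowExtension T i j i≤j j<n

    tightness : (σ : ℕ) → 3 ≤ σ → (n i j : ℕ) → 1 ≤ i → i ≤ j → j < n → 5 ≤ suc j ∸ i →
                (∃ λ (T : Vec (Fin σ) n) → #SymDiff T i (suc j) i j ≡ 4)
                × ((∃ λ (T : Vec (Fin σ) n) → #MUS T i (suc j) ≡ #MUS T i j + 2)
                × (∃ λ (T : Vec (Fin σ) n) → #MUS T i j ≡ #MUS T i (suc j) + 1))
    tightness (suc (suc (suc σ′))) (s≤s (s≤s (s≤s _))) n i j 1≤i i≤j j<n 5≤|W|
      with d , refl ← m≤n⇒∃[o]m+o≡n (≤-pred (subst (5 + i ≤_) (m∸n+n≡m (≤-trans i≤j (n≤1+n j))) (+-monoˡ-≤ i 5≤|W|)))
      = (Words.word n TA.f , proj₁ TA.extremal) , (Words.word n TA.f , proj₂ TA.extremal) ,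
        (Words.word n OR.f , OR.decrease)
      where
        module TA = ThreeAdded σ′ n i (suc (i + d)) 1≤i (s≤s (m≤m+n i d)) j<n
        module OR = OneRemoved σ′ n i (3 + (i + d)) 1≤i (s≤s (s≤s (s≤s (m≤m+n i d)))) j<n
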